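{- Let $G$ be a formula and let $\sigma_1,\sigma_2$ be $\mathbf{FRJ}(G)$-sequents. (i) If $\sigma_1\mapsto_0\sigma_2$ via an instance of a rule $\mathcal R$ of $\mathbf{FRJ}(G)$ other than $\supset_{\notin}$, then $\mathrm{Lhs}(\sigma_2)\subseteq\mathrm{Lhs}(\sigma_1)$. (ii) If $\sigma_1\mapsto_0\sigma_2$ then $\mathrm{Lhs}(\sigma_2)\subseteq\mathrm{Cl}(\mathrm{Lhs}(\sigma_1))$. (iii) If $\sigma_1\mapsto_*\sigma_2$ then $\mathrm{Lhs}(\sigma_2)\subseteq\mathrm{Cl}(\mathrm{Lhs}(\sigma_1))$. Here $\mathbf{FRJ}(G)$ is the calculus below without the restrictions (R1)–(R4).
   Context: Formulas are built from a countably infinite set $\mathcal{V}$ of propositional variables and $\bot$ using $\land,\lor,\supset$. Let $\mathcal{V}_\bot=\mathcal{V}\cup\{\bot\}$, $\mathcal{L}^{\supset}$ the set of formulas with main connective $\supset$. For a formula $G$, $\mathrm{Sl}(G)$ and $\mathrm{Sr}(G)$ are the smallest subsets of the subformulas of $G$ with: $G\in\mathrm{Sr}(G)$; $A\land B$ or $A\lor B$ in $\mathrm{Sl}(G)$ (resp. $\mathrm{Sr}(G)$) implies $A,B$ in $\mathrm{Sl}(G)$ (resp. $\mathrm{Sr}(G)$); $A\supset B\in\mathrm{Sl}(G)$ implies $B\in\mathrm{Sl}(G)$, $A\in\mathrm{Sr}(G)$; $A\supset B\in\mathrm{Sr}(G)$ implies $B\in\mathrm{Sr}(G)$, $A\in\mathrm{Sl}(G)$.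 $\mathrm{Cl}(\Gamma)$ is the smallest set containing $\Gamma$ such that if $X,Y\in\mathrm{Cl}(\Gamma)$ and $A$ is any formula then $X\land Y,A\lor X,X\lor A,A\supset X\in\mathrm{Cl}(\Gamma)$. $\mathbf{FRJ}(G)$: let $\bar\Gamma^{At}=\mathrm{Sl}(G)\cap\mathcal V$, $\bar\Gamma^{\supset}=\mathrm{Sl}(G)\cap\mathcal L^{\supset}$, $\bar\Gamma=\bar\Gamma^{At}\cup\bar\Gamma^{\supset}$. Sequents: regular $\Gamma\Rightarrow C$ ($\Gamma\subseteq\bar\Gamma$, $C\in\mathrm{Sr}(G)$), irregular $\Sigma;\Theta\rightarrow C$ ($\Sigma\cup\Theta\subseteq\bar\Gamma$, $C\in\mathrm{Sr}(G)$); $\mathrm{Lhs}(\Gamma\Rightarrow C)=\Gamma$, $\mathrm{Lhs}(\Sigma;\Theta\rightarrow C)=\Sigma\cup\Theta$; conclusions always have right formula in $\mathrm{Sr}(G)$. Rules ($F\in\mathcal V_\bot$, $k\in\{1,2\}$): axioms $\bar\Gamma^{At}\setminus\{F\}\Rightarrow F$ and $\emptyset;(\bar\Gamma^{At}\setminus\{F\})\cup\bar\Gamma^{\supset}\rightarrow F$; ($\land$) $\Gamma\Rightarrow A_k/\Gamma\Rightarrow A_1\land A_2$ and $\Sigma;\Theta\rightarrow A_k/\Sigma;\Theta\rightarrow A_1\land A_2$; ($\lor$) $\Sigma_1;\Theta_1\rightarrow C_1$, $\Sigma_2;\Theta_2\rightarrow C_2 / \Sigma_1\cup\Sigma_2;\Theta_1\cap\Theta_2\rightarrow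 C_1\lor C_2$ if $\Sigma_1\subseteq\Sigma_2\cup\Theta_2$, $\Sigma_2\subseteq\Sigma_1\cup\Theta_1$; ($\supset_\in$) $\Gamma\Rightarrow B/\Gamma\Rightarrow A\supset B$ if $A\in\mathrm{Cl}(\Gamma)$, and $\Sigma;\Theta\cup\Lambda\rightarrow B/\Sigma\cup\Lambda;\Theta\rightarrow A\supset B$ if $\Theta\cap\Lambda=\emptyset$ and $A\in\mathrm{Cl}(\Sigma\cup\Lambda)$; ($\supset_{\notin}$) $\Gamma\Rightarrow B/\emptyset;\Theta\rightarrow A\supset B$ if $\Theta\subseteq\mathrm{Cl}(\Gamma)\cap\bar\Gamma$ and $A\in\mathrm{Cl}(\Gamma)\setminus\mathrm{Cl}(\Theta)$; join rules with premises $\Sigma_j;\Theta_j\rightarrow A_j$ ($1\le j\le n$, $n\ge1$): let $\Upsilon=\{A_1,\dots,A_n\}$, $\Sigma^{At}=\bigcup_j(\Sigma_j\cap\mathcal V)$, $\Sigma^{\supset}=\bigcup_j(\Sigma_j\cap\mathcal L^{\supset})$, $\Theta^{At}=\bigcap_j(\Theta_j\cap\mathcal V)$, $\Theta^{\supset}=\{Y\supset Z\in\bigcap_j(\Theta_j\cap\mathcal L^{\supset}):Y\in\Upsilon\}$, requiring $\Sigma_i\subseteq\Sigma_j\cup\Theta_j$ ($i\ne j$) and ($Y\supset Z\in\Sigma^{\supset}\Rightarrow Y\in\Upsilon$); ($\bowtie^{At}$) conclusion $\Sigma^{At}\cup(\Theta^{At}\setminus\{F\})\cup\Sigma^{\supset}\cup\Theta^{\supset}\Rightarrow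 F$, $F\in\mathcal V_\bot\setminus\Sigma^{At}$; ($\bowtie^{\lor}$) conclusion $\Sigma^{At}\cup\Theta^{At}\cup\Sigma^{\supset}\cup\Theta^{\supset}\Rightarrow C_1\lor C_2$, $\{C_1,C_2\}\subseteq\Upsilon$. (The restrictions (R1)–(R4) are minimality of $\Lambda$, maximality of $\Theta$, and extra conditions on $\Upsilon$ in joins; they are not imposed here.) Write $\sigma_1\mapsto_0\sigma_2$ if some rule instance has conclusion $\sigma_2$ and $\sigma_1$ among its premises; $\mapsto_*$ is the reflexive-transitive closure of $\mapsto_0$. -}

module Defs where

open import Level using (0ℓ)
open import Data.Nat using (ℕ; zero; suc)
open import Data.Fin using (Fin; zero; suc)
open import Data.Product using (Σ; ∃; ∃-syntax; _×_; _,_)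
open import Data.Sum using (_⊎_)
open import Data.Empty using (⊥)
open import Relation.Nullary using (¬_)
open import Relation.Binary.PropositionalEquality using (_≡_; _≢_)
open import Relation.Unary using (Pred; _⊆_; _≐_; _∪_; _∩_; ∅)
open import Relation.Binary.Construct.Closure.ReflexiveTransitive using (Star)

infixr 7 _∧_
infixr 6 _∨_
infixr 5 _⊃_

data Formula : Set where
  var : ℕ → Formula
  bot : Formula
  _∧_ _∨_ _⊃_ : Formula → Formula → Formula

FSet : Set₁
FSet = Pred Formula 0ℓ

IsVar : Formula → Set
IsVar F = ∃[ n ] F ≡ var n

IsAtom : Formula → Set
IsAtom F = IsVar F ⊎ F ≡ bot

IsImp : Formula → Set
IsImp F = ∃[ A ] ∃[ B ] F ≡ (A ⊃ B)

_∖[_] : FSet → Formula → FSet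
(X ∖[ F ]) x = X x × x ≢ F

mutual
  data Sr (G : Formula) : Formula → Set where
    sr-G   : Sr G G
    sr-∧ˡ  : ∀ {A B} → Sr G (A ∧ B) → Sr G A
    sr-∧ʳ  : ∀ {A B} → Sr G (A ∧ B) → Sr G B
    sr-∨ˡ  : ∀ {A B} → Sr G (A ∨ B) → Sr G A
    sr-∨ʳ  : ∀ {A B} → Sr G (A ∨ B) → Sr G B
    sr-⊃ʳ  : ∀ {A B} → Sr G (A ⊃ B) → Sr G B
    sl-⊃ˡ  : ∀ {A B} → Sl G (A ⊃ B) → Sr G A

  data Sl (G : Formula) : Formula → Set where
    sl-∧ˡ  : ∀ {A B} → Sl G (A ∧ B) → Sl G A
    sl-∧ʳ  : ∀ {A B} → Sl G (A ∧ B) → Sl G B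
    sl-∨ˡ  : ∀ {A B} → Sl G (A ∨ B) → Sl G A
    sl-∨ʳ  : ∀ {A B} → Sl G (A ∨ B) → Sl G B
    sl-⊃ʳ  : ∀ {A B} → Sl G (A ⊃ B) → Sl G B
    sr-⊃ˡ  : ∀ {A B} → Sr G (A ⊃ B) → Sl G A

data Cl (Γ : FSet) : Formula → Set where
  cl-base : ∀ {X} → Γ X → Cl Γ X
  cl-∧    : ∀ {X Y} → Cl Γ X → Cl Γ Y → Cl Γ (X ∧ Y)
  cl-∨ˡ   : ∀ {X} A → Cl Γ X → Cl Γ (A ∨ X)
  cl-∨ʳ   : ∀ {X} A → Cl Γ X → Cl Γ (X ∨ A)
  cl-⊃    : ∀ {X} A → Cl Γ X → Cl Γ (A ⊃ X)

data Seq : Set₁ where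
  reg : FSet → Formula → Seq
  irr : FSet → FSet → Formula → Seq

Lhs : Seq → FSet
Lhs (reg Γ C)   = Γ
Lhs (irr Σ Θ C) = Σ ∪ Θ

module _ (G : Formula) where

  ΓAt : FSet
  ΓAt x = Sl G x × IsVar x

  Γimp : FSet
  Γimp x = Sl G x × IsImp x

  Γbar : FSet
  Γbar = ΓAt ∪ Γimp

  IsSeq : Seq → Set
  IsSeq (reg Γ C)   = (Γ ⊆ Γbar) × Sr G C
  IsSeq (irr Σ Θ C) = ((Σ ∪ Θ) ⊆ Γbar) × Sr G C

data RuleName : Set where
  axiom and or impIn impNotIn joinAt joinOr : RuleName

one : Seq → Fin 1 → Seq
one σ _ = σ

two : Seq → Seq → Fin 2 → Seq
two σ τ zero    = σ
two σ τ (suc _) = τ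

-- sets of conclusions are matched up to extensional equality (_≐_)
data Inst (G : Formula) : RuleName → {n : ℕ} → (Fin n → Seq) → Seq → Set₁ where
  ax-reg : ∀ {ps : Fin 0 → Seq} {F Γ} → IsAtom F →
           Γ ≐ (ΓAt G ∖[ F ]) →
           Inst G axiom ps (reg Γ F)
  ax-irr : ∀ {ps : Fin 0 → Seq} {F Σ Θ} → IsAtom F →
           Σ ≐ ∅ → Θ ≐ ((ΓAt G ∖[ F ]) ∪ Γimp G) →
           Inst G axiom ps (irr Σ Θ F)
  and-reg : ∀ {Γ Γ' Ak} A₁ A₂ → (Ak ≡ A₁ ⊎ Ak ≡ A₂) → Γ' ≐ Γ →
            Inst G and (one (reg Γ Ak)) (reg Γ' (A₁ ∧ A₂))
  and-irr : ∀ {Σ Θ Σ' Θ' Ak} A₁ A₂ → (Ak ≡ A₁ ⊎ Ak ≡ A₂) → Σ' ≐ Σ → Θ' ≐ Θ →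
            Inst G and (one (irr Σ Θ Ak)) (irr Σ' Θ' (A₁ ∧ A₂))
  or-irr : ∀ {Σ₁ Θ₁ C₁ Σ₂ Θ₂ C₂ Σ Θ} →
           Σ₁ ⊆ (Σ₂ ∪ Θ₂) → Σ₂ ⊆ (Σ₁ ∪ Θ₁) →
           Σ ≐ (Σ₁ ∪ Σ₂) → Θ ≐ (Θ₁ ∩ Θ₂) →
           Inst G or (two (irr Σ₁ Θ₁ C₁) (irr Σ₂ Θ₂ C₂)) (irr Σ Θ (C₁ ∨ C₂))
  impIn-reg : ∀ {Γ Γ' A B} → Cl Γ A → Γ' ≐ Γ →
              Inst G impIn (one (reg Γ B)) (reg Γ' (A ⊃ B))
  impIn-irr : ∀ {Σ Θ Λ Θ₀ Σ' Θ' A B} →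
              Θ₀ ≐ (Θ ∪ Λ) → (∀ x → ¬ (Θ x × Λ x)) → Cl (Σ ∪ Λ) A →
              Σ' ≐ (Σ ∪ Λ) → Θ' ≐ Θ →
              Inst G impIn (one (irr Σ Θ₀ B)) (irr Σ' Θ' (A ⊃ B))
  impNotIn-rule : ∀ {Γ Σ Θ A B} →
              Θ ⊆ (Cl Γ ∩ Γbar G) → Cl Γ A → ¬ Cl Θ A → Σ ≐ ∅ →
              Inst G impNotIn (one (reg Γ B)) (irr Σ Θ (A ⊃ B))
  join-At : ∀ {m} (Σs Θs : Fin (suc m) → FSet) (As : Fin (suc m) → Formula) {Γ F} →
            let Υ   : FSet
                Υ y = ∃[ j ] As j ≡ y
                ΣAt : FSet
                ΣAt x = IsVar x × ∃[ j ] Σs j x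
                Σimp : FSet
                Σimp x = IsImp x × ∃[ j ] Σs j x
                ΘAt : FSet
                ΘAt x = IsVar x × (∀ j → Θs j x)
                Θimp : FSet
                Θimp x = ∃[ Y ] ∃[ Z ] x ≡ (Y ⊃ Z) × (∀ j → Θs j x) × Υ Y
            in (∀ i j → i ≢ j → Σs i ⊆ (Σs j ∪ Θs j)) →
               (∀ Y Z → Σimp (Y ⊃ Z) → Υ Y) →
               IsAtom F → ¬ ΣAt F →
               Γ ≐ (ΣAt ∪ (ΘAt ∖[ F ]) ∪ Σimp ∪ Θimp) →
               Inst G joinAt (λ j → irr (Σs j) (Θs j) (As j)) (reg Γ F)
  join-Or : ∀ {m} (Σs Θs : Fin (suc m) → FSet) (As : Fin (suc m) → Formula) {Γ C₁ C₂} →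
            let Υ   : FSet
                Υ y = ∃[ j ] As j ≡ y
                ΣAt : FSet
                ΣAt x = IsVar x × ∃[ j ] Σs j x
                Σimp : FSet
                Σimp x = IsImp x × ∃[ j ] Σs j x
                ΘAt : FSet
                ΘAt x = IsVar x × (∀ j → Θs j x)
                Θimp : FSet
                Θimp x = ∃[ Y ] ∃[ Z ] x ≡ (Y ⊃ Z) × (∀ j → Θs j x) × Υ Y
            in (∀ i j → i ≢ j → Σs i ⊆ (Σs j ∪ Θs j)) →
               (∀ Y Z → Σimp (Y ⊃ Z) → Υ Y) →
               Υ C₁ → Υ C₂ →
               Γ ≐ (ΣAt ∪ ΘAt ∪ Σimp ∪ Θimp) →
               Inst G joinOr (λ j → irr (Σs j) (Θs j) (As j)) (reg Γ (C₁ ∨ C₂))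

StepVia : Formula → RuleName → Seq → Seq → Set₁
StepVia G R σ₁ σ₂ =
  Σ ℕ λ n → Σ (Fin n → Seq) λ ps →
    Inst G R ps σ₂ × (∀ j → IsSeq G (ps j)) × IsSeq G σ₂ × (∃[ j ] ps j ≡ σ₁)

Step : Formula → Seq → Seq → Set₁
Step G σ₁ σ₂ = Σ RuleName λ R → StepVia G R σ₁ σ₂

Steps : Formula → Seq → Seq → Set₁
Steps G = Star (Step G)

-- Every rule except ⊃∉ builds the left-hand side of its conclusion from
-- formulas on the left of each premise: the ∨ and join rules take unions of
-- the Σs and intersections of the Θs, and the side conditions Σᵢ ⊆ Σⱼ ∪ Θⱼ
-- put every Σᵢ on the left of every premise.  Rule ⊃∉ has Σ = ∅ and requires
-- Θ ⊆ Cl(Γ).  Since Cl is a closure operator, the inclusion in Cl survives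
-- chains of steps.
module Submission where

open import Defs
open import Data.Fin using (Fin; zero; suc)
open import Data.Fin.Properties using (_≟_)
open import Data.Product using (_×_; ∃-syntax; _,_; proj₁; proj₂)
open import Data.Sum using (_⊎_; inj₁; inj₂)
open import Data.Empty using (⊥-elim)
open import Function using (_∘_)
open import Relation.Nullary using (Dec; yes; no)
open import Relation.Binary.Definitions using (DecidableEquality)
open import Relation.Binary.PropositionalEquality using (_≡_; _≢_; refl)
open import Relation.Binary.Construct.Closure.ReflexiveTransitive using (ε; _◅_)
open import Relation.Unary using (_⊆_; _∪_)

Cl-bind : {Γ Δ : FSet} → Γ ⊆ Cl Δ → Cl Γ ⊆ Cl Δ
Cl-bind f (cl-base x)  = f x
Cl-bind f (cl-∧ x y)   = cl-∧ (Cl-bind f x) (Cl-bind f y)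
Cl-bind f (cl-∨ˡ A x)  = cl-∨ˡ A (Cl-bind f x)
Cl-bind f (cl-∨ʳ A x)  = cl-∨ʳ A (Cl-bind f x)
Cl-bind f (cl-⊃ A x)   = cl-⊃ A (Cl-bind f x)

module _ {I : Set} (_≟ᵢ_ : DecidableEquality I) (Σs Θs : I → FSet)
         (cover : ∀ i j → i ≢ j → Σs i ⊆ Σs j ∪ Θs j) where

  ⋃Σ∪⋂Θ⊆Σ∪Θ : ∀ j {x} → (∃[ i ] Σs i x) ⊎ (∀ i → Θs i x) → (Σs j ∪ Θs j) x
  ⋃Σ∪⋂Θ⊆Σ∪Θ j (inj₁ (i , x∈Σᵢ)) with i ≟ᵢ j
  ... | yes refl = inj₁ x∈Σᵢ
  ... | no  i≢j  = cover i j i≢j x∈Σᵢ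
  ⋃Σ∪⋂Θ⊆Σ∪Θ j (inj₂ x∈Θ) = inj₂ (x∈Θ j)

impNotIn? : (R : RuleName) → Dec (R ≡ impNotIn)
impNotIn? axiom    = no λ ()
impNotIn? and      = no λ ()
impNotIn? or       = no λ ()
impNotIn? impIn    = no λ ()
impNotIn? impNotIn = yes refl
impNotIn? joinAt   = no λ ()
impNotIn? joinOr   = no λ ()

Inst-Lhs-⊆ : ∀ {G R n} {ps : Fin n → Seq} {σ} → R ≢ impNotIn → Inst G R ps σ →
             ∀ j → Lhs σ ⊆ Lhs (ps j)
Inst-Lhs-⊆ _ (ax-reg _ _) ()
Inst-Lhs-⊆ _ (ax-irr _ _ _) ()
Inst-Lhs-⊆ _ (and-reg _ _ _ Γ≐) _ = proj₁ Γ≐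
Inst-Lhs-⊆ _ (and-irr _ _ _ Σ≐ Θ≐) _ (inj₁ x) = inj₁ (proj₁ Σ≐ x)
Inst-Lhs-⊆ _ (and-irr _ _ _ Σ≐ Θ≐) _ (inj₂ x) = inj₂ (proj₁ Θ≐ x)
Inst-Lhs-⊆ _ (or-irr Σ₁⊆ Σ₂⊆ Σ≐ _) j (inj₁ x) with proj₁ Σ≐ x | j
... | inj₁ x∈Σ₁ | zero  = inj₁ x∈Σ₁
... | inj₁ x∈Σ₁ | suc _ = Σ₁⊆ x∈Σ₁
... | inj₂ x∈Σ₂ | zero  = Σ₂⊆ x∈Σ₂
... | inj₂ x∈Σ₂ | suc _ = inj₁ x∈Σ₂
Inst-Lhs-⊆ _ (or-irr _ _ _ Θ≐) zero    (inj₂ x) = inj₂ (proj₁ (proj₁ Θ≐ x))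
Inst-Lhs-⊆ _ (or-irr _ _ _ Θ≐) (suc _) (inj₂ x) = inj₂ (proj₂ (proj₁ Θ≐ x))
Inst-Lhs-⊆ _ (impIn-reg _ Γ≐) _ = proj₁ Γ≐
Inst-Lhs-⊆ _ (impIn-irr Θ₀≐ _ _ Σ≐ Θ≐) _ (inj₁ x) with proj₁ Σ≐ x
... | inj₁ x∈Σ = inj₁ x∈Σ
... | inj₂ x∈Λ = inj₂ (proj₂ Θ₀≐ (inj₂ x∈Λ))
Inst-Lhs-⊆ _ (impIn-irr Θ₀≐ _ _ _ Θ≐) _ (inj₂ x) = inj₂ (proj₂ Θ₀≐ (inj₁ (proj₁ Θ≐ x)))
Inst-Lhs-⊆ R≢ (impNotIn-rule _ _ _ _) _ _ = ⊥-elim (R≢ refl)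
Inst-Lhs-⊆ _ (join-At Σs Θs _ cover _ _ _ Γ≐) j x
  with ⋃Σ∪⋂Θ⊆Σ∪Θ _≟_ Σs Θs cover j | proj₁ Γ≐ x
... | ⊆Σⱼ∪Θⱼ | inj₁ (_ , x∈Σ)                           = ⊆Σⱼ∪Θⱼ (inj₁ x∈Σ)
... | ⊆Σⱼ∪Θⱼ | inj₂ (inj₁ ((_ , x∈Θ) , _))               = ⊆Σⱼ∪Θⱼ (inj₂ x∈Θ)
... | ⊆Σⱼ∪Θⱼ | inj₂ (inj₂ (inj₁ (_ , x∈Σ)))             = ⊆Σⱼ∪Θⱼ (inj₁ x∈Σ)
... | ⊆Σⱼ∪Θⱼ | inj₂ (inj₂ (inj₂ (_ , _ , _ , x∈Θ , _))) = ⊆Σⱼ∪Θⱼ (inj₂ x∈Θ)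
Inst-Lhs-⊆ _ (join-Or Σs Θs _ cover _ _ _ Γ≐) j x
  with ⋃Σ∪⋂Θ⊆Σ∪Θ _≟_ Σs Θs cover j | proj₁ Γ≐ x
... | ⊆Σⱼ∪Θⱼ | inj₁ (_ , x∈Σ)                           = ⊆Σⱼ∪Θⱼ (inj₁ x∈Σ)
... | ⊆Σⱼ∪Θⱼ | inj₂ (inj₁ (_ , x∈Θ))                     = ⊆Σⱼ∪Θⱼ (inj₂ x∈Θ)
... | ⊆Σⱼ∪Θⱼ | inj₂ (inj₂ (inj₁ (_ , x∈Σ)))             = ⊆Σⱼ∪Θⱼ (inj₁ x∈Σ)
... | ⊆Σⱼ∪Θⱼ | inj₂ (inj₂ (inj₂ (_ , _ , _ , x∈Θ , _))) = ⊆Σⱼ∪Θⱼ (inj₂ x∈Θ)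

impNotIn-Lhs-⊆Cl : ∀ {G n} {ps : Fin n → Seq} {σ} → Inst G impNotIn ps σ →
                   ∀ j → Lhs σ ⊆ Cl (Lhs (ps j))
impNotIn-Lhs-⊆Cl (impNotIn-rule _ _ _ Σ≐∅) _ (inj₁ x∈Σ) = ⊥-elim (proj₁ Σ≐∅ x∈Σ)
impNotIn-Lhs-⊆Cl (impNotIn-rule Θ⊆ _ _ _)  _ (inj₂ x∈Θ) = proj₁ (Θ⊆ x∈Θ)

Inst-Lhs-⊆Cl : ∀ {G R n} {ps : Fin n → Seq} {σ} → Inst G R ps σ →
               ∀ j → Lhs σ ⊆ Cl (Lhs (ps j))
Inst-Lhs-⊆Cl {R = R} inst j with impNotIn? R
... | yes refl = impNotIn-Lhs-⊆Cl inst j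
... | no  R≢   = cl-base ∘ Inst-Lhs-⊆ R≢ inst j

StepVia-Lhs-⊆ : ∀ {G R σ₁ σ₂} → R ≢ impNotIn → StepVia G R σ₁ σ₂ → Lhs σ₂ ⊆ Lhs σ₁
StepVia-Lhs-⊆ R≢ (_ , _ , inst , _ , _ , j , refl) = Inst-Lhs-⊆ R≢ inst j

Step-Lhs-⊆Cl : ∀ {G σ₁ σ₂} → Step G σ₁ σ₂ → Lhs σ₂ ⊆ Cl (Lhs σ₁)
Step-Lhs-⊆Cl (_ , _ , _ , inst , _ , _ , j , refl) = Inst-Lhs-⊆Cl inst j

Steps-Lhs-⊆Cl : ∀ {G σ₁ σ₂} → Steps G σ₁ σ₂ → Lhs σ₂ ⊆ Cl (Lhs σ₁)
Steps-Lhs-⊆Cl ε              = cl-base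
Steps-Lhs-⊆Cl (step ◅ steps) = Cl-bind (Step-Lhs-⊆Cl step) ∘ Steps-Lhs-⊆Cl steps

lemma3p5 : (G : Formula) →
    ((R : RuleName) → R ≢ impNotIn → (σ₁ σ₂ : Seq) → IsSeq G σ₁ → IsSeq G σ₂ →
        StepVia G R σ₁ σ₂ → Lhs σ₂ ⊆ Lhs σ₁)
    × ((σ₁ σ₂ : Seq) → IsSeq G σ₁ → IsSeq G σ₂ →
        Step G σ₁ σ₂ → Lhs σ₂ ⊆ Cl (Lhs σ₁))
    × ((σ₁ σ₂ : Seq) → IsSeq G σ₁ → IsSeq G σ₂ →
        Steps G σ₁ σ₂ → Lhs σ₂ ⊆ Cl (Lhs σ₁))
lemma3p5 G =
    (λ _ R≢ _ _ _ _ → StepVia-Lhs-⊆ R≢)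
  , (λ _ _ _ _ → Step-Lhs-⊆Cl)
  , (λ _ _ _ _ → Steps-Lhs-⊆Cl)
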